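{- Let $G$ be a connected graph of order $n$. Then $\rho_{o}(G)\leq n-\Delta(G)+1$. Moreover, equality holds if and only if $\Delta(G)=n-1$ and $\delta(G)=1$.
   Context: All graphs are finite and simple. $\Delta(G)$ and $\delta(G)$ denote the maximum and minimum degree. For a vertex $v$, $N(v)$ is its open neighborhood. A set $B\subseteq V(G)$ is an open packing if $|N(v)\cap B|\le 1$ for all $v\in V(G)$ (equivalently, the open neighborhoods of the vertices of $B$ are pairwise disjoint); $\rho_o(G)$ is the maximum size of an open packing in $G$. -}

module Defs where

open import Data.Nat using (ℕ; zero; suc; _≤_; _⊔_; _⊓_)
open import Data.Bool using (Bool; true; false)
open import Data.Fin using (Fin)
open import Data.Fin.Subset using (Subset; _∩_; ∣_∣)
open import Data.Vec using (tabulate)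
open import Data.List using (List; foldr; allFin)
open import Data.Product using (Σ; _×_)
open import Relation.Binary.PropositionalEquality using (_≡_)

record Graph (n : ℕ) : Set where
  field
    adj    : Fin n → Fin n → Bool
    sym    : ∀ u v → adj u v ≡ adj v u
    irrefl : ∀ v → adj v v ≡ false
open Graph public

module _ {n : ℕ} (G : Graph n) where

  N : Fin n → Subset n
  N v = tabulate (adj G v)

  deg : Fin n → ℕ
  deg v = ∣ N v ∣

  -- maximum degree (0 for the empty graph)
  Δ : ℕ
  Δ = foldr (λ v m → deg v ⊔ m) 0 (allFin n)

  -- minimum degree (every degree is < n, so starting from n gives the true minimum when n ≥ 1)
  δ : ℕ
  δ = foldr (λ v m → deg v ⊓ m) n (allFin n)

  data Reachable : Fin n → Fin n → Set where
    here : ∀ {v} → Reachable v v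
    step : ∀ {u w v} → adj G u w ≡ true → Reachable w v → Reachable u v

  Connected : Set
  Connected = ∀ u v → Reachable u v

  IsOpenPacking : Subset n → Set
  IsOpenPacking B = ∀ v → ∣ N v ∩ B ∣ ≤ 1

  IsOpenPackingNumber : ℕ → Set
  IsOpenPackingNumber k =
    Σ (Subset n) (λ B → IsOpenPacking B × ∣ B ∣ ≡ k)
    × (∀ B → IsOpenPacking B → ∣ B ∣ ≤ k)

module Submission where

-- For any vertex v and open packing B, inclusion–exclusion gives
--   deg v + |B| = |N(v) ∪ B| + |N(v) ∩ B| ≤ n + 1,
-- since |N(v) ∩ B| ≤ 1 by the packing property.  Take v of maximum degree.  If B is tight for a max-degree vertex v, then
-- N(v) ∪ B is the whole vertex set; as v ∉ N(v) we get v ∈ B.  Any vertex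
-- outside N[v] would, by connectivity, give an edge xy with x ∈ N(v) and
-- y ∉ N[v]; then y ∈ B and x has the two B-neighbours v, y.  So v is
-- universal, Δ = n − 1, |B| = 2, and the second vertex u of B has N(u) ⊆ {v},
-- whence δ ≤ 1; connectivity gives δ ≥ 1.
-- Star ⇒ equality.  A universal vertex v and a vertex u ≠ v of degree ≤ 1
-- form the open packing {v, u}, so ρ ≥ 2 = n − Δ + 1.

open import Defs renaming (sym to adj-sym)
open import Data.Nat using (ℕ; suc; _≤_; _<_; _+_; _∸_; _⊔_; _⊓_; z≤n; s≤s)
open import Data.Nat.Properties
open import Data.Bool using (true; false)
open import Data.Fin using (Fin; fromℕ<) renaming (_≟_ to _≟ᶠ_)
open import Data.Fin.Properties using (any?)
open import Data.Fin.Subset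
open import Data.Fin.Subset.Properties
open import Data.Vec using ([]; _∷_)
open import Data.Vec.Properties using (lookup∘tabulate; []=⇒lookup; lookup⇒[]=)
open import Data.List as List using (List; foldr; allFin)
open import Data.List.Membership.Propositional using () renaming (_∈_ to _∈ˡ_)
open import Data.List.Membership.Propositional.Properties using (∈-allFin)
open import Data.List.Relation.Unary.Any using (here; there)
open import Data.Product using (∃; ∃₂; _×_; _,_; proj₁)
open import Data.Sum as Sum using (_⊎_; inj₁; inj₂; [_,_]′)
open import Function.Bundles using (_⇔_; mk⇔)
open import Relation.Nullary using (yes; no; contradiction)
open import Relation.Nullary.Decidable using (_×-dec_; ¬?)
open import Relation.Binary.PropositionalEquality
  using (_≡_; _≢_; refl; sym; trans; cong; subst; subst₂; module ≡-Reasoning)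

∣∪∣+∣∩∣ : ∀ {n} (p q : Subset n) → ∣ p ∪ q ∣ + ∣ p ∩ q ∣ ≡ ∣ p ∣ + ∣ q ∣
∣∪∣+∣∩∣ [] [] = refl
∣∪∣+∣∩∣ (true ∷ p) (true ∷ q) =
  cong suc (trans (+-suc ∣ p ∪ q ∣ ∣ p ∩ q ∣)
                  (trans (cong suc (∣∪∣+∣∩∣ p q)) (sym (+-suc ∣ p ∣ ∣ q ∣))))
∣∪∣+∣∩∣ (true ∷ p) (false ∷ q) = cong suc (∣∪∣+∣∩∣ p q)
∣∪∣+∣∩∣ (false ∷ p) (true ∷ q) = trans (cong suc (∣∪∣+∣∩∣ p q)) (sym (+-suc ∣ p ∣ ∣ q ∣))
∣∪∣+∣∩∣ (false ∷ p) (false ∷ q) = ∣∪∣+∣∩∣ p q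

∣p∪q∣≤∣p∣+∣q∣ : ∀ {n} (p q : Subset n) → ∣ p ∪ q ∣ ≤ ∣ p ∣ + ∣ q ∣
∣p∪q∣≤∣p∣+∣q∣ p q = subst (∣ p ∪ q ∣ ≤_) (∣∪∣+∣∩∣ p q) (m≤m+n ∣ p ∪ q ∣ ∣ p ∩ q ∣)

∈⇒1≤∣p∣ : ∀ {n} {x : Fin n} {p : Subset n} → x ∈ p → 1 ≤ ∣ p ∣
∈⇒1≤∣p∣ {x = x} x∈p =
  subst (_≤ _) (∣⁅x⁆∣≡1 x) (p⊆q⇒∣p∣≤∣q∣ λ y∈⁅x⁆ → subst (_∈ _) (sym (x∈⁅y⁆⇒x≡y x y∈⁅x⁆)) x∈p)

1≤∣p∣⇒nonempty : ∀ {n} (p : Subset n) → 1 ≤ ∣ p ∣ → Nonempty p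
1≤∣p∣⇒nonempty {n} p 1≤∣p∣ with nonempty? p
... | yes ne = ne
... | no empty = contradiction (subst (λ q → 1 ≤ ∣ q ∣) (Empty-unique empty) 1≤∣p∣)
                               (λ 1≤∣⊥∣ → 1+n≰n (subst (1 ≤_) (∣⊥∣≡0 n) 1≤∣⊥∣))

distinct⇒2≤∣p∣ : ∀ {n} {x y : Fin n} {p : Subset n} → x ∈ p → y ∈ p → x ≢ y → 2 ≤ ∣ p ∣
distinct⇒2≤∣p∣ x∈p y∈p x≢y =
  <-≤-trans (s≤s (∈⇒1≤∣p∣ (x∈p∧x≢y⇒x∈p-y y∈p (λ y≡x → x≢y (sym y≡x))))) (x∈p⇒∣p-x∣<∣p∣ x∈p)

∣p∣≤1⇒unique : ∀ {n} {x y : Fin n} {p : Subset n} → ∣ p ∣ ≤ 1 → x ∈ p → y ∈ p → x ≡ y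
∣p∣≤1⇒unique {x = x} {y} ∣p∣≤1 x∈p y∈p with x ≟ᶠ y
... | yes x≡y = x≡y
... | no x≢y = contradiction (≤-trans (distinct⇒2≤∣p∣ x∈p y∈p x≢y) ∣p∣≤1) 1+n≰n

⊆⁅⁆⇒∣p∣≤1 : ∀ {n} {c : Fin n} {p : Subset n} → p ⊆ ⁅ c ⁆ → ∣ p ∣ ≤ 1
⊆⁅⁆⇒∣p∣≤1 {c = c} p⊆⁅c⁆ = subst (_ ≤_) (∣⁅x⁆∣≡1 c) (p⊆q⇒∣p∣≤∣q∣ p⊆⁅c⁆)

another-element : ∀ {n} {x : Fin n} {p : Subset n} → 2 ≤ ∣ p ∣ → x ∈ p → ∃ λ y → y ∈ p × y ≢ x
another-element {x = x} {p} 2≤∣p∣ x∈p with any? (λ y → y ∈? p ×-dec ¬? (y ≟ᶠ x))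
... | yes found = found
... | no none = contradiction (≤-trans 2≤∣p∣ (⊆⁅⁆⇒∣p∣≤1 p⊆⁅x⁆)) 1+n≰n
  where
  p⊆⁅x⁆ : p ⊆ ⁅ x ⁆
  p⊆⁅x⁆ {y} y∈p with y ≟ᶠ x
  ... | yes refl = x∈⁅x⁆ x
  ... | no y≢x = contradiction (y , y∈p , y≢x) none

∉⇒∣p∣<n : ∀ {n} {x : Fin n} {p : Subset n} → x ∉ p → ∣ p ∣ < n
∉⇒∣p∣<n {n} {x} {p} x∉p = subst (∣ p ∣ <_) (∣⊤∣≡n n)
  (≤-<-trans (p⊆q⇒∣p∣≤∣q∣ p⊆⊤-x) (x∈p⇒∣p-x∣<∣p∣ (∈⊤ {x = x})))
  where
  p⊆⊤-x : p ⊆ ⊤ - x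
  p⊆⊤-x {y} y∈p = x∈p∧x≢y⇒x∈p-y ∈⊤ (λ { refl → x∉p y∈p })

∉∉⇒2+∣p∣≤n : ∀ {n} {x y : Fin n} {p : Subset n} → x ∉ p → y ∉ p → x ≢ y → 2 + ∣ p ∣ ≤ n
∉∉⇒2+∣p∣≤n {n} {x} {y} {p} x∉p y∉p x≢y = subst (2 + ∣ p ∣ ≤_) (∣⊤∣≡n n) (begin-strict
  suc ∣ p ∣             ≤⟨ s≤s (p⊆q⇒∣p∣≤∣q∣ p⊆⊤-x-y) ⟩
  suc ∣ ⊤ - x - y ∣     ≤⟨ x∈p⇒∣p-x∣<∣p∣ y∈⊤-x ⟩
  ∣ ⊤ {n} - x ∣         <⟨ x∈p⇒∣p-x∣<∣p∣ (∈⊤ {x = x}) ⟩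
  ∣ ⊤ {n} ∣             ∎)
  where
  open ≤-Reasoning
  y∈⊤-x : y ∈ ⊤ - x
  y∈⊤-x = x∈p∧x≢y⇒x∈p-y ∈⊤ (λ y≡x → x≢y (sym y≡x))
  p⊆⊤-x-y : p ⊆ ⊤ - x - y
  p⊆⊤-x-y {z} z∈p = x∈p∧x≢y⇒x∈p-y (x∈p∧x≢y⇒x∈p-y ∈⊤ (λ { refl → x∉p z∈p })) (λ { refl → y∉p z∈p })

co-singleton⇒n≤1+∣p∣ : ∀ {n} {x : Fin n} {p : Subset n} → (∀ y → y ≢ x → y ∈ p) → n ≤ suc ∣ p ∣
co-singleton⇒n≤1+∣p∣ {n} {x} {p} covers = begin
  n                 ≡⟨ sym (∣⊤∣≡n n) ⟩
  ∣ ⊤ {n} ∣         ≤⟨ p⊆q⇒∣p∣≤∣q∣ ⊤⊆p∪⁅x⁆ ⟩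
  ∣ p ∪ ⁅ x ⁆ ∣     ≤⟨ ∣p∪q∣≤∣p∣+∣q∣ p ⁅ x ⁆ ⟩
  ∣ p ∣ + ∣ ⁅ x ⁆ ∣ ≡⟨ cong (∣ p ∣ +_) (∣⁅x⁆∣≡1 x) ⟩
  ∣ p ∣ + 1         ≡⟨ +-comm ∣ p ∣ 1 ⟩
  suc ∣ p ∣         ∎
  where
  open ≤-Reasoning
  ⊤⊆p∪⁅x⁆ : ⊤ ⊆ p ∪ ⁅ x ⁆
  ⊤⊆p∪⁅x⁆ {y} _ with y ≟ᶠ x
  ... | yes refl = x∈p∪q⁺ (inj₂ (x∈⁅x⁆ x))
  ... | no y≢x = x∈p∪q⁺ (inj₁ (covers y y≢x))

∣p∣≡n⇒∈ : ∀ {n} {p : Subset n} → ∣ p ∣ ≡ n → ∀ x → x ∈ p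
∣p∣≡n⇒∈ ∣p∣≡n x = subst (x ∈_) (sym (∣p∣≡n⇒p≡⊤ ∣p∣≡n)) ∈⊤

∣p∣≤1⇒⊆⁅⁆ : ∀ {n} {c : Fin n} {p : Subset n} → ∣ p ∣ ≤ 1 → c ∈ p → p ⊆ ⁅ c ⁆
∣p∣≤1⇒⊆⁅⁆ {c = c} ∣p∣≤1 c∈p x∈p = subst (_∈ ⁅ c ⁆) (∣p∣≤1⇒unique ∣p∣≤1 c∈p x∈p) (x∈⁅x⁆ c)

∈⁅⁆∪⁅⁆⁻ : ∀ {n} {x a b : Fin n} → x ∈ ⁅ a ⁆ ∪ ⁅ b ⁆ → x ≡ a ⊎ x ≡ b
∈⁅⁆∪⁅⁆⁻ {a = a} {b} x∈ = Sum.map (x∈⁅y⁆⇒x≡y a) (x∈⁅y⁆⇒x≡y b) (x∈p∪q⁻ ⁅ a ⁆ ⁅ b ⁆ x∈)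

∩-pinned⇒∣p∩q∣≤1 : ∀ {n} {c : Fin n} {p q : Subset n} → (∀ {x} → x ∈ p → x ∈ q → x ≡ c) →
                   ∣ p ∩ q ∣ ≤ 1
∩-pinned⇒∣p∩q∣≤1 {c = c} {p} {q} pinned = ⊆⁅⁆⇒∣p∣≤1 λ {x} x∈p∩q →
  let (x∈p , x∈q) = x∈p∩q⁻ p q x∈p∩q in subst (_∈ ⁅ c ⁆) (sym (pinned x∈p x∈q)) (x∈⁅x⁆ c)

foldr-selective : ∀ {A : Set} (_∙_ : ℕ → ℕ → ℕ) → (∀ a b → a ∙ b ≡ a ⊎ a ∙ b ≡ b) →
  (f : A → ℕ) (e : ℕ) (xs : List A) →
  foldr (λ v m → f v ∙ m) e xs ≡ e ⊎ ∃ λ x → foldr (λ v m → f v ∙ m) e xs ≡ f x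
foldr-selective _∙_ sel f e List.[] = inj₁ refl
foldr-selective _∙_ sel f e (x List.∷ xs) with sel (f x) (foldr (λ v m → f v ∙ m) e xs)
... | inj₁ picks-x = inj₂ (x , picks-x)
... | inj₂ picks-rest with foldr-selective _∙_ sel f e xs
...   | inj₁ rest≡e = inj₁ (trans picks-rest rest≡e)
...   | inj₂ (y , rest≡fy) = inj₂ (y , trans picks-rest rest≡fy)

f≤foldr-⊔ : ∀ {A : Set} (f : A → ℕ) {x : A} {xs : List A} → x ∈ˡ xs →
  f x ≤ foldr (λ v m → f v ⊔ m) 0 xs
f≤foldr-⊔ f (here refl) = m≤m⊔n _ _
f≤foldr-⊔ f (there x∈xs) = ≤-trans (f≤foldr-⊔ f x∈xs) (m≤n⊔m _ _)

foldr-⊓≤f : ∀ {A : Set} (f : A → ℕ) (e : ℕ) {x : A} {xs : List A} → x ∈ˡ xs →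
  foldr (λ v m → f v ⊓ m) e xs ≤ f x
foldr-⊓≤f f e (here refl) = m⊓n≤m _ _
foldr-⊓≤f f e (there x∈xs) = ≤-trans (m⊓n≤n _ _) (foldr-⊓≤f f e x∈xs)

foldr-⊓-glb : ∀ {A : Set} (f : A → ℕ) {k e : ℕ} (xs : List A) → k ≤ e → (∀ x → k ≤ f x) →
  k ≤ foldr (λ v m → f v ⊓ m) e xs
foldr-⊓-glb f List.[] k≤e k≤f = k≤e
foldr-⊓-glb f (x List.∷ xs) k≤e k≤f = ⊓-glb (k≤f x) (foldr-⊓-glb f xs k≤e k≤f)

+≤⇒≤∸+ : ∀ {d n r} → d ≤ n → d + r ≤ n + 1 → r ≤ n ∸ d + 1
+≤⇒≤∸+ {d} {n} {r} d≤n d+r≤ = subst₂ _≤_ (m+n∸m≡n d r) (+-∸-comm 1 d≤n) (∸-monoˡ-≤ d d+r≤)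

≡∸+⇒+≡ : ∀ {d n r} → d ≤ n → r ≡ n ∸ d + 1 → d + r ≡ n + 1
≡∸+⇒+≡ {d} {n} d≤n refl = trans (sym (+-assoc d (n ∸ d) 1)) (cong (_+ 1) (m+[n∸m]≡n d≤n))

suc≡⇒∸+1≡2 : ∀ {d n} → suc d ≡ n → n ∸ d + 1 ≡ 2
suc≡⇒∸+1≡2 {d} refl = cong (_+ 1) (m+n∸n≡m 1 d)

≡∸1⇒suc≡ : ∀ {d n} → Fin n → d ≡ n ∸ 1 → suc d ≡ n
≡∸1⇒suc≡ {n = suc n} _ refl = refl

module _ {n : ℕ} (G : Graph n) where

  adj⇒∈N : ∀ {v x} → adj G v x ≡ true → x ∈ N G v
  adj⇒∈N {v} {x} vx = lookup⇒[]= x (N G v) (trans (lookup∘tabulate (adj G v) x) vx)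

  ∈N⇒adj : ∀ {v x} → x ∈ N G v → adj G v x ≡ true
  ∈N⇒adj {v} {x} x∈Nv = trans (sym (lookup∘tabulate (adj G v) x)) ([]=⇒lookup x∈Nv)

  N-sym : ∀ {v x} → x ∈ N G v → v ∈ N G x
  N-sym {v} {x} x∈Nv = adj⇒∈N (trans (adj-sym G x v) (∈N⇒adj x∈Nv))

  v∉Nv : ∀ v → v ∉ N G v
  v∉Nv v v∈Nv with trans (sym (∈N⇒adj v∈Nv)) (irrefl G v)
  ... | ()

  deg<n : ∀ v → deg G v < n
  deg<n v = ∉⇒∣p∣<n (v∉Nv v)

  deg≤Δ : ∀ v → deg G v ≤ Δ G
  deg≤Δ v = f≤foldr-⊔ (deg G) (∈-allFin v)

  δ≤deg : ∀ v → δ G ≤ deg G v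
  δ≤deg v = foldr-⊓≤f (deg G) n (∈-allFin v)

  Δ≤n : Δ G ≤ n
  Δ≤n with foldr-selective _⊔_ ⊔-sel (deg G) 0 (allFin n)
  ... | inj₁ Δ≡0 = subst (_≤ n) (sym Δ≡0) z≤n
  ... | inj₂ (x , Δ≡deg) = subst (_≤ n) (sym Δ≡deg) (<⇒≤ (deg<n x))

  Δ-attained : Fin n → ∃ λ v → deg G v ≡ Δ G
  Δ-attained z with foldr-selective _⊔_ ⊔-sel (deg G) 0 (allFin n)
  ... | inj₁ Δ≡0 = z , ≤-antisym (deg≤Δ z) (subst (_≤ deg G z) (sym Δ≡0) z≤n)
  ... | inj₂ (x , Δ≡deg) = x , sym Δ≡deg

  -- If δ > 0 then some vertex has minimum degree (the seed n of the fold is never the minimum).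
  δ-attained : 0 < δ G → ∃ λ v → deg G v ≡ δ G
  δ-attained 0<δ with foldr-selective _⊓_ ⊓-sel (deg G) n (allFin n)
  ... | inj₂ (x , δ≡deg) = x , sym δ≡deg
  ... | inj₁ δ≡n = contradiction (≤-<-trans (δ≤deg z) (subst (deg G z <_) (sym δ≡n) (deg<n z))) (<-irrefl refl)
    where
    z : Fin n
    z = fromℕ< (subst (0 <_) δ≡n 0<δ)

  δ-glb : ∀ {k} → k ≤ n → (∀ v → k ≤ deg G v) → k ≤ δ G
  δ-glb k≤n k≤deg = foldr-⊓-glb (deg G) (allFin n) k≤n k≤deg

  Universal : Fin n → Set
  Universal v = ∀ w → w ≢ v → w ∈ N G v

  universal⇒deg : ∀ {v} → Universal v → suc (deg G v) ≡ n
  universal⇒deg {v} univ = ≤-antisym (deg<n v) (co-singleton⇒n≤1+∣p∣ univ)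

  deg⇒universal : ∀ {v} → suc (deg G v) ≡ n → Universal v
  deg⇒universal {v} deg≡ w w≢v with w ∈? N G v
  ... | yes w∈Nv = w∈Nv
  ... | no w∉Nv = contradiction (subst (2 + deg G v ≤_) (sym deg≡)
                    (∉∉⇒2+∣p∣≤n (v∉Nv v) w∉Nv (λ v≡w → w≢v (sym v≡w)))) 1+n≰n

  boundary-edge : (S : Subset n) {u w : Fin n} → Reachable G u w → u ∈ S → w ∉ S →
                  ∃₂ λ x y → x ∈ S × y ∉ S × y ∈ N G x
  boundary-edge S here u∈S u∉S = contradiction u∈S u∉S
  boundary-edge S (step {w = u′} uu′ walk) u∈S w∉S with u′ ∈? S
  ... | yes u′∈S = boundary-edge S walk u′∈S w∉S
  ... | no u′∉S = _ , u′ , u∈S , u′∉S , adj⇒∈N uu′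

  connected⇒1≤deg : Connected G → ∀ {v} w → w ≢ v → 1 ≤ deg G v
  connected⇒1≤deg conn {v} w w≢v with conn v w
  ... | here = contradiction refl w≢v
  ... | step vx _ = ∈⇒1≤∣p∣ (adj⇒∈N vx)

  packing-unique : ∀ {B z a b} → IsOpenPacking G B →
                   a ∈ N G z → b ∈ N G z → a ∈ B → b ∈ B → a ≡ b
  packing-unique {z = z} packing a∈Nz b∈Nz a∈B b∈B =
    ∣p∣≤1⇒unique (packing z) (x∈p∩q⁺ (a∈Nz , a∈B)) (x∈p∩q⁺ (b∈Nz , b∈B))

  packing-bound : ∀ {B} → IsOpenPacking G B → ∀ v → deg G v + ∣ B ∣ ≤ n + 1
  packing-bound {B} packing v = begin
    deg G v + ∣ B ∣                      ≡⟨ sym (∣∪∣+∣∩∣ (N G v) B) ⟩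
    ∣ N G v ∪ B ∣ + ∣ N G v ∩ B ∣        ≤⟨ +-mono-≤ (∣p∣≤n (N G v ∪ B)) (packing v) ⟩
    n + 1                                ∎
    where open ≤-Reasoning

  Δ-packing-bound : ∀ {B} → IsOpenPacking G B → Δ G + ∣ B ∣ ≤ n + 1
  Δ-packing-bound {B} packing with foldr-selective _⊔_ ⊔-sel (deg G) 0 (allFin n)
  ... | inj₁ Δ≡0 = subst (λ d → d + ∣ B ∣ ≤ n + 1) (sym Δ≡0) (≤-trans (∣p∣≤n B) (m≤m+n n 1))
  ... | inj₂ (x , Δ≡deg) = subst (λ d → d + ∣ B ∣ ≤ n + 1) (sym Δ≡deg) (packing-bound packing x)

  tight-cover : ∀ {B v} → IsOpenPacking G B → deg G v + ∣ B ∣ ≡ n + 1 → ∀ x → x ∈ N G v ⊎ x ∈ B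
  tight-cover {B} {v} packing tight x = x∈p∪q⁻ (N G v) B (∣p∣≡n⇒∈ ∣N∪B∣≡n x)
    where
    open ≤-Reasoning
    ∣N∪B∣≡n : ∣ N G v ∪ B ∣ ≡ n
    ∣N∪B∣≡n = ≤-antisym (∣p∣≤n (N G v ∪ B)) (+-cancelʳ-≤ 1 n ∣ N G v ∪ B ∣ (begin
      n + 1                             ≡⟨ sym tight ⟩
      deg G v + ∣ B ∣                   ≡⟨ sym (∣∪∣+∣∩∣ (N G v) B) ⟩
      ∣ N G v ∪ B ∣ + ∣ N G v ∩ B ∣     ≤⟨ +-monoʳ-≤ ∣ N G v ∪ B ∣ (packing v) ⟩
      ∣ N G v ∪ B ∣ + 1                 ∎))

  tight⇒centre∈B : ∀ {B v} → IsOpenPacking G B → deg G v + ∣ B ∣ ≡ n + 1 → v ∈ B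
  tight⇒centre∈B {v = v} packing tight with tight-cover packing tight v
  ... | inj₁ v∈Nv = contradiction v∈Nv (v∉Nv v)
  ... | inj₂ v∈B = v∈B

  N[_] : Fin n → Subset n
  N[ v ] = ⁅ v ⁆ ∪ N G v

  v∈N[v] : ∀ v → v ∈ N[ v ]
  v∈N[v] v = x∈p∪q⁺ (inj₁ (x∈⁅x⁆ v))

  N⊆N[] : ∀ {v x} → x ∈ N G v → x ∈ N[ v ]
  N⊆N[] x∈Nv = x∈p∪q⁺ (inj₂ x∈Nv)

  ∈N[]⁻ : ∀ {v x} → x ∈ N[ v ] → x ≡ v ⊎ x ∈ N G v
  ∈N[]⁻ {v} x∈N[v] with x∈p∪q⁻ ⁅ v ⁆ (N G v) x∈N[v]
  ... | inj₁ x∈⁅v⁆ = inj₁ (x∈⁅y⁆⇒x≡y v x∈⁅v⁆)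
  ... | inj₂ x∈Nv = inj₂ x∈Nv

  distance-two : ∀ {v w} → Reachable G v w → w ∉ N[ v ] →
                 ∃₂ λ x y → x ∈ N G v × y ∈ N G x × y ∉ N[ v ]
  distance-two {v} walk w∉N[v] with boundary-edge N[ v ] walk (v∈N[v] v) w∉N[v]
  ... | x , y , x∈N[v] , y∉N[v] , y∈Nx with ∈N[]⁻ x∈N[v]
  ...   | inj₁ refl = contradiction (N⊆N[] y∈Nx) y∉N[v]
  ...   | inj₂ x∈Nv = x , y , x∈Nv , y∈Nx , y∉N[v]

  -- In a connected graph a tight vertex v is universal: a vertex y at distance
  -- two from v would lie in B (by tight-cover) and share the neighbour x with v ∈ B.
  tight⇒universal : Connected G → ∀ {B v} → IsOpenPacking G B → deg G v + ∣ B ∣ ≡ n + 1 → Universal v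
  tight⇒universal conn {B} {v} packing tight w w≢v with w ∈? N G v
  ... | yes w∈Nv = w∈Nv
  ... | no w∉Nv with distance-two (conn v w) (λ w∈N[v] → [ w≢v , w∉Nv ]′ (∈N[]⁻ w∈N[v]))
  ...   | x , y , x∈Nv , y∈Nx , y∉N[v] with tight-cover packing tight y
  ...     | inj₁ y∈Nv = contradiction (N⊆N[] y∈Nv) y∉N[v]
  ...     | inj₂ y∈B = contradiction (subst (_∈ N[ v ]) v≡y (v∈N[v] v)) y∉N[v]
    where
    v≡y : v ≡ y
    v≡y = packing-unique packing (N-sym x∈Nv) y∈Nx (tight⇒centre∈B packing tight) y∈B

  -- In a packing containing a universal vertex v, every other member u has
  -- N(u) ⊆ {v}: a neighbour y ≠ v of u is adjacent to both u and v.
  packing-partner : ∀ {B v u} → IsOpenPacking G B → Universal v → v ∈ B → u ∈ B → u ≢ v →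
                    N G u ⊆ ⁅ v ⁆
  packing-partner {v = v} packing univ v∈B u∈B u≢v {y} y∈Nu with y ≟ᶠ v
  ... | yes refl = x∈⁅x⁆ v
  ... | no y≢v = contradiction (packing-unique packing (N-sym y∈Nu) (N-sym (univ y y≢v)) u∈B v∈B) u≢v

  -- Conversely, {v, u} is an open packing whenever N(u) ⊆ {v}: the only
  -- possible member of N(z) ∩ {v, u} is u when z = v, and v otherwise.
  pair-packing : ∀ {v u} → N G u ⊆ ⁅ v ⁆ → IsOpenPacking G (⁅ v ⁆ ∪ ⁅ u ⁆)
  pair-packing {v} {u} Nu⊆⁅v⁆ z with z ≟ᶠ v
  ... | yes refl = ∩-pinned⇒∣p∩q∣≤1 only-u
    where
    only-u : ∀ {x} → x ∈ N G z → x ∈ ⁅ z ⁆ ∪ ⁅ u ⁆ → x ≡ u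
    only-u x∈Nz x∈pair with ∈⁅⁆∪⁅⁆⁻ x∈pair
    ... | inj₁ refl = contradiction x∈Nz (v∉Nv z)
    ... | inj₂ x≡u = x≡u
  ... | no z≢v = ∩-pinned⇒∣p∩q∣≤1 only-v
    where
    only-v : ∀ {x} → x ∈ N G z → x ∈ ⁅ v ⁆ ∪ ⁅ u ⁆ → x ≡ v
    only-v x∈Nz x∈pair with ∈⁅⁆∪⁅⁆⁻ x∈pair
    ... | inj₁ x≡v = x≡v
    ... | inj₂ refl = contradiction (x∈⁅y⁆⇒x≡y v (Nu⊆⁅v⁆ (N-sym x∈Nz))) z≢v

  -- If v is a universal vertex of maximum degree and δ = 1, some u ≠ v has N(u) ⊆ {v}:
  -- either a minimum-degree vertex other than v, or (if v itself has degree 1) its neighbour.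
  pendant-vertex : ∀ {v} → Universal v → deg G v ≡ Δ G → δ G ≡ 1 → ∃ λ u → u ≢ v × N G u ⊆ ⁅ v ⁆
  pendant-vertex {v} univ degv≡Δ δ≡1 with δ-attained (subst (0 <_) (sym δ≡1) (s≤s z≤n))
  ... | x , degx≡δ with x ≟ᶠ v
  ...   | no x≢v = x , x≢v , ∣p∣≤1⇒⊆⁅⁆ (≤-reflexive (trans degx≡δ δ≡1)) (N-sym (univ x x≢v))
  ...   | yes refl with 1≤∣p∣⇒nonempty (N G x) (≤-reflexive (sym (trans degx≡δ δ≡1)))
  ...     | u , u∈Nx = u , (λ { refl → v∉Nv u u∈Nx }) , ∣p∣≤1⇒⊆⁅⁆ degu≤1 (N-sym u∈Nx)
    where
    degu≤1 : deg G u ≤ 1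
    degu≤1 = ≤-trans (deg≤Δ u) (≤-reflexive (trans (sym degv≡Δ) (trans degx≡δ δ≡1)))

  connected⇒1≤δ : Connected G → ∀ {u v} → u ≢ v → 1 ≤ δ G
  connected⇒1≤δ conn {u} {v} u≢v = δ-glb (<-≤-trans (s≤s z≤n) (deg<n v)) has-neighbour
    where
    has-neighbour : ∀ x → 1 ≤ deg G x
    has-neighbour x with x ≟ᶠ v
    ... | yes refl = connected⇒1≤deg conn u u≢v
    ... | no x≢v = connected⇒1≤deg conn v (λ v≡x → x≢v (sym v≡x))

  -- Tightness at a vertex v forces a star-like structure: v is universal and
  -- lies in B, so |B| = 2, and the other member u of B is pendant at v.
  tight-at⇒star : Connected G → ∀ {B v} → IsOpenPacking G B → deg G v + ∣ B ∣ ≡ n + 1 →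
                  suc (deg G v) ≡ n × δ G ≡ 1
  tight-at⇒star conn {B} {v} packing tight = suc-deg≡n , ≤-antisym δ≤1 1≤δ
    where
    univ : Universal v
    univ = tight⇒universal conn packing tight
    v∈B : v ∈ B
    v∈B = tight⇒centre∈B packing tight
    suc-deg≡n : suc (deg G v) ≡ n
    suc-deg≡n = universal⇒deg univ
    ∣B∣≡2 : ∣ B ∣ ≡ 2
    ∣B∣≡2 = +-cancelˡ-≡ (deg G v) ∣ B ∣ 2 (begin
      deg G v + ∣ B ∣       ≡⟨ tight ⟩
      n + 1                 ≡⟨ cong (_+ 1) (sym suc-deg≡n) ⟩
      suc (deg G v) + 1     ≡⟨ sym (+-suc (deg G v) 1) ⟩
      deg G v + 2           ∎)
      where open ≡-Reasoning
    partner : ∃ λ u → u ∈ B × u ≢ v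
    partner = another-element (≤-reflexive (sym ∣B∣≡2)) v∈B
    δ≤1 : δ G ≤ 1
    δ≤1 with partner
    ... | u , u∈B , u≢v = ≤-trans (δ≤deg u) (⊆⁅⁆⇒∣p∣≤1 (packing-partner packing univ v∈B u∈B u≢v))
    1≤δ : 1 ≤ δ G
    1≤δ with partner
    ... | u , _ , u≢v = connected⇒1≤δ conn u≢v

  -- Equality in the bound Δ + |B| ≤ n + 1 forces Δ = n − 1 and δ = 1: a tight B
  -- is nonempty, so a maximum-degree vertex exists and is tight.
  tight-packing⇒star : Connected G → ∀ {B} → IsOpenPacking G B → Δ G + ∣ B ∣ ≡ n + 1 →
                       suc (Δ G) ≡ n × δ G ≡ 1
  tight-packing⇒star conn {B} packing tight with 1≤∣p∣⇒nonempty B 1≤∣B∣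
    where
    1≤∣B∣ : 1 ≤ ∣ B ∣
    1≤∣B∣ = +-cancelˡ-≤ n 1 ∣ B ∣ (≤-trans (≤-reflexive (sym tight)) (+-monoˡ-≤ ∣ B ∣ Δ≤n))
  ... | b , _ with Δ-attained b
  ...   | v , degv≡Δ =
    subst (λ d → suc d ≡ n × δ G ≡ 1) degv≡Δ
          (tight-at⇒star conn packing (subst (λ d → d + ∣ B ∣ ≡ n + 1) (sym degv≡Δ) tight))

  star⇒pair-packing : suc (Δ G) ≡ n → δ G ≡ 1 → ∃ λ B → IsOpenPacking G B × 2 ≤ ∣ B ∣
  star⇒pair-packing sucΔ≡n δ≡1 with δ-attained (subst (0 <_) (sym δ≡1) (s≤s z≤n))
  ... | x , _ with Δ-attained x
  ...   | v , degv≡Δ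
    with pendant-vertex (deg⇒universal (subst (λ d → suc d ≡ n) (sym degv≡Δ) sucΔ≡n)) degv≡Δ δ≡1
  ...     | u , u≢v , Nu⊆⁅v⁆ =
    ⁅ v ⁆ ∪ ⁅ u ⁆ , pair-packing Nu⊆⁅v⁆ ,
    distinct⇒2≤∣p∣ (x∈p∪q⁺ (inj₁ (x∈⁅x⁆ v))) (x∈p∪q⁺ (inj₂ (x∈⁅x⁆ u))) (λ v≡u → u≢v (sym v≡u))

mainTheorem4 : ∀ {n : ℕ} (G : Graph n) → Connected G → ∀ (ρ : ℕ) → IsOpenPackingNumber G ρ
    → (ρ ≤ n ∸ Δ G + 1) × (ρ ≡ n ∸ Δ G + 1 ⇔ (Δ G ≡ n ∸ 1 × δ G ≡ 1))
mainTheorem4 {n} G conn ρ ((B , packing , ∣B∣≡ρ) , maximal) = bound , mk⇔ tight⇒star star⇒tight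
  where
  bound : ρ ≤ n ∸ Δ G + 1
  bound = +≤⇒≤∸+ (Δ≤n G) (subst (λ r → Δ G + r ≤ n + 1) ∣B∣≡ρ (Δ-packing-bound G packing))

  tight⇒star : ρ ≡ n ∸ Δ G + 1 → Δ G ≡ n ∸ 1 × δ G ≡ 1
  tight⇒star ρ≡ with tight-packing⇒star G conn packing (≡∸+⇒+≡ (Δ≤n G) (trans ∣B∣≡ρ ρ≡))
  ... | sucΔ≡n , δ≡1 = cong (_∸ 1) sucΔ≡n , δ≡1

  star⇒tight : Δ G ≡ n ∸ 1 × δ G ≡ 1 → ρ ≡ n ∸ Δ G + 1
  star⇒tight (Δ≡n∸1 , δ≡1) = ≤-antisym bound (subst (_≤ ρ) (sym (suc≡⇒∸+1≡2 sucΔ≡n)) 2≤ρ)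
    where
    sucΔ≡n : suc (Δ G) ≡ n
    sucΔ≡n = ≡∸1⇒suc≡ (proj₁ (δ-attained G (subst (0 <_) (sym δ≡1) (s≤s z≤n)))) Δ≡n∸1
    2≤ρ : 2 ≤ ρ
    2≤ρ with star⇒pair-packing G sucΔ≡n δ≡1
    ... | B′ , packing′ , 2≤∣B′∣ = ≤-trans 2≤∣B′∣ (maximal B′ packing′)
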